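{- For every hook composition tableau $F$ and every $x\in\mathcal{A}\cup\mathcal{A}'$, the filling $F\leftarrow x$ produced by the insertion algorithm is a hook composition tableau.
   Context: Fix $k,l\ge0$, $\mathcal{A}=\{1,\dots,k\}$, $\mathcal{A}'=\{1',\dots,l'\}$, totally ordered $1<\dots<k<1'<\dots<l'$; $\infty$ is larger than every letter and lies in neither alphabet. French notation: row $i$ is the $i$-th from the bottom, cell $(i,j)$ is row $i$, column $j$. For a composition $\alpha=(\alpha_1,\dots,\alpha_r)$ with largest part $m$ the diagram has $\alpha_i$ cells in row $i$. Hook composition tableau (HCT) of shape $\alpha$: a filling $F$ with letters of $\mathcal{A}\cup\mathcal{A}'$ such that rows weakly increase left to right; unprimed entries weakly and primed entries strictly increase along rows; in the leftmost column unprimed entries strictly and primed entries weakly increase bottom to top; and, with $\hat F$ the $r\times m$ array having $\infty$ in the missing cells, for all $1\le i<j\le r$, $1\le n<m$: (a) if $\hat F(i,n+1)\in\mathcal{A}$ and $\hat F(i,n+1)\ge\hat F(j,n)$ then $\hat F(i,n+1)>\hat F(j,n+1)$; (b) if $\hat F(i,n+1)\in\mathcal{A}'$ and $\hat F(i,n+1)>\hat F(j,n)$ then $\hat F(i,n+1)\ge\hat F(j,n+1)$. Reading order: read down each column (top to bottom), starting with the rightmost column and moving left. Insertion $F\leftarrow x$: pad $F$ with $\infty$ in all cells $(i,j)$ with $\alpha_i<j\le m+1$ and scan in reading order. (a) If $x\in\mathcal{A}$, $x$ bumps (replaces) the first scanned entry $\hat F(i,j)$ with $j\ne1$, $\hat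 F(i,j)>x$, $\hat F(i,j-1)\le x$; if none exists, $x$ forms a new row of length 1 inserted in the first column between rows $i,i+1$ with $\hat F(i,1)<x<\hat F(i+1,1)$, or at the bottom if $x<\hat F(1,1)$. (b) If $x\in\mathcal{A}'$, $x$ bumps the first scanned entry with $j\ne1$, $\hat F(i,j)\ge x$, $\hat F(i,j-1)<x$; if none exists, $x$ forms a new row of length 1 in the first column between rows with $\hat F(i,1)<x\le\hat F(i+1,1)$, or at the bottom if $x\le\hat F(i,1)$ for all $i$. If the bumped entry is $\infty$ or a new row was created, stop; otherwise the bumped entry becomes the new $x$ and scanning continues from the cell immediately after $(i,j)$ in reading order. -}

module Defs where

open import Data.Nat.Base using (ℕ; zero; suc; pred; _+_; _≤_; _<_; _⊔_; _≤ᵇ_; _<ᵇ_)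
open import Data.Fin.Base using (Fin; toℕ)
open import Data.List.Base using (List; []; _∷_; length; map; concatMap; foldr; downFrom)
open import Data.Bool.Base using (Bool; true; false; if_then_else_; _∧_)
open import Data.Product.Base using (_×_; _,_)

-- Alphabet A ∪ A' with A = {1,…,k}, A' = {1',…,l'}
-- un a  is the unprimed letter (toℕ a + 1)
-- pr b  is the primed letter (toℕ b + 1)'

data Letter (k l : ℕ) : Set where
  un : Fin k → Letter k l
  pr : Fin l → Letter k l

data Ext (k l : ℕ) : Set where
  lt : Letter k l → Ext k l
  ∞  : Ext k l

-- position in the total order 1 < … < k < 1' < … < l' < ∞
rank : ∀ {k l} → Ext k l → ℕ
rank         (lt (un a)) = toℕ a
rank {k}     (lt (pr b)) = k + toℕ b
rank {k} {l} ∞           = k + l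

_≤ₑ_ : ∀ {k l} → Ext k l → Ext k l → Set
x ≤ₑ y = rank x ≤ rank y

_<ₑ_ : ∀ {k l} → Ext k l → Ext k l → Set
x <ₑ y = rank x < rank y

data Unprimed {k l : ℕ} : Ext k l → Set where
  isUn : (a : Fin k) → Unprimed (lt (un a))

data Primed {k l : ℕ} : Ext k l → Set where
  isPr : (b : Fin l) → Primed (lt (pr b))

-- Fillings (French notation): a list of rows, the head is the bottom
-- row (row 1 of the paper).  Each row lists its entries left to right.
-- Indices below are 0-based: paper cell (i , j) is (i ∸ 1 , j ∸ 1).

Filling : ℕ → ℕ → Set
Filling k l = List (List (Letter k l))

lookupℕ : ∀ {A : Set} → List A → ℕ → List A
lookupℕ []       _       = []
lookupℕ (x ∷ _)  zero    = x ∷ []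
lookupℕ (_ ∷ xs) (suc n) = lookupℕ xs n

numRows : ∀ {k l} → Filling k l → ℕ
numRows = length

rowLen : ∀ {k l} → Filling k l → ℕ → ℕ
rowLen []         _       = 0
rowLen (row ∷ _)  zero    = length row
rowLen (_ ∷ rows) (suc i) = rowLen rows i

maxLen : ∀ {k l} → Filling k l → ℕ
maxLen = foldr (λ row m → length row ⊔ m) 0

entryRow : ∀ {k l} → List (Letter k l) → ℕ → Ext k l
entryRow []       _       = ∞
entryRow (x ∷ _)  zero    = lt x
entryRow (_ ∷ xs) (suc j) = entryRow xs j

hat : ∀ {k l} → Filling k l → ℕ → ℕ → Ext k l
hat []           _       _ = ∞
hat (row ∷ _)    zero    j = entryRow row j
hat (_ ∷ rows)   (suc i) j = hat rows i j

record IsHCT {k l : ℕ} (F : Filling k l) : Set where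
  field
    composition : ∀ i → i < numRows F → 1 ≤ rowLen F i
    rowWeak : ∀ i j j' → i < numRows F → j < j' → j' < rowLen F i →
              hat F i j ≤ₑ hat F i j'
    rowPrimedStrict : ∀ i j j' → i < numRows F → j < j' → j' < rowLen F i →
              Primed (hat F i j) → Primed (hat F i j') → hat F i j <ₑ hat F i j'
    colWeak : ∀ i i' → i < i' → i' < numRows F → hat F i 0 ≤ₑ hat F i' 0
    colUnprimedStrict : ∀ i i' → i < i' → i' < numRows F →
              Unprimed (hat F i 0) → Unprimed (hat F i' 0) → hat F i 0 <ₑ hat F i' 0
    -- triple condition (a); paper's n (1 ≤ n < m) is n + 1 here
    tripleA : ∀ i j n → i < j → j < numRows F → suc n < maxLen F →
              Unprimed (hat F i (suc n)) → hat F j n ≤ₑ hat F i (suc n) →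
              hat F j (suc n) <ₑ hat F i (suc n)
    tripleB : ∀ i j n → i < j → j < numRows F → suc n < maxLen F →
              Primed (hat F i (suc n)) → hat F j n <ₑ hat F i (suc n) →
              hat F j (suc n) ≤ₑ hat F i (suc n)

setRow : ∀ {A : Set} → List A → ℕ → A → List A
setRow []       zero    x = x ∷ []
setRow []       (suc _) _ = []
setRow (_ ∷ ys) zero    x = x ∷ ys
setRow (y ∷ ys) (suc j) x = y ∷ setRow ys j x

setCell : ∀ {k l} → Filling k l → ℕ → ℕ → Letter k l → Filling k l
setCell []           _       _ _ = []
setCell (row ∷ rows) zero    j x = setRow row j x ∷ rows
setCell (row ∷ rows) (suc i) j x = row ∷ setCell rows i j x

bumps : ∀ {k l} → Letter k l → Ext k l → Ext k l → Bool
bumps {k} {l} x@(un _) cur left = (rank {k} {l} (lt x) <ᵇ rank cur) ∧ (rank left ≤ᵇ rank {k} {l} (lt x))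
bumps {k} {l} x@(pr _) cur left = (rank {k} {l} (lt x) ≤ᵇ rank cur) ∧ (rank left <ᵇ rank {k} {l} (lt x))

newRow : ∀ {k l} → Letter k l → Filling k l → Filling k l
newRow x []           = (x ∷ []) ∷ []
newRow x (row ∷ rows) =
  if rank (entryRow row 0) <ᵇ rank (lt x)
  then row ∷ newRow x rows
  else (x ∷ []) ∷ row ∷ rows

-- reading order of the padded array (r rows, m + 1 columns), omitting
-- the first column (which is never bumped): columns m, m-1, …, 1
-- (0-based), each read from the top row r-1 down to row 0
readingOrder : ℕ → ℕ → List (ℕ × ℕ)
readingOrder r m = concatMap (λ c → map (λ i → (i , c)) (downFrom r)) (map suc (downFrom m))

scan : ∀ {k l} → Letter k l → List (ℕ × ℕ) → Filling k l → Filling k l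
scan x []             F = newRow x F
scan x ((i , j) ∷ ps) F with bumps x (hat F i j) (hat F i (pred j))
... | false = scan x ps F
... | true with hat F i j
...   | ∞    = setCell F i j x
...   | lt y = scan y ps (setCell F i j x)

insert : ∀ {k l} → Filling k l → Letter k l → Filling k l
insert F x = scan x (readingOrder (numRows F) (maxLen F)) F

module Submission where

-- The rank conditions defining an HCT are strict or weak according to whether
-- the letters involved are primed.  We absorb this into two orders on extended
-- letters, defined through doubled ranks: a ≺ b ("a < b, or a = b primed") and
-- a ⪯ b ("a < b, or a = b unprimed").  They compose like < and ≤, are
-- complementary, and the bumping test of the insertion is exactly
-- "x ≺ cur and left ⪯ x".  With them an HCT is equivalently a LocalHCT: rows
-- are ⪯-chains, the first column is a ≺-chain, and every triple (a ; b , c)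
-- satisfies "a ≺ b or c ≺ a".
--
-- Writing x into a bumpable cell
-- keeps a LocalHCT as long as x separates the neighbouring horizontal pairs of
-- the other rows (bump-local).  Scanning a column maintains this separation
-- for the current letter (scan-column); after the last column the letter
-- separates the first two columns of every row, which is exactly what a new
-- row of length one needs (newRow-local).

open import Defs
open import Data.Nat.Base
open import Data.Nat.Properties
open import Data.Fin.Base using (toℕ)
open import Data.Fin.Properties using (toℕ<n)
open import Data.Empty using (⊥; ⊥-elim)
open import Data.Sum.Base using (_⊎_; inj₁; inj₂)
open import Data.Product.Base using (_×_; _,_; proj₂; ∃)
open import Data.List.Base using (List; []; _∷_; length; map; downFrom; _++_)
open import Data.Bool.Base using (true; false; T)
open import Data.Bool.Properties using (T-∧; T-≡)
open import Function.Bundles using (Equivalence)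
open import Relation.Nullary using (¬_; yes; no)
open import Relation.Binary.PropositionalEquality using (_≡_; _≢_; refl; sym; trans; cong; subst; subst₂)

-- double n = 2n, by recursion so that its order properties follow by induction.
double : ℕ → ℕ
double zero    = zero
double (suc n) = suc (suc (double n))

double-mono : ∀ {a b} → a ≤ b → double a ≤ double b
double-mono z≤n     = z≤n
double-mono (s≤s p) = s≤s (s≤s (double-mono p))

double-gap : ∀ {a b} → a < b → 2 + double a ≤ double b
double-gap (s≤s p) = s≤s (s≤s (double-mono p))

double-≤-cancel : ∀ a b → double a ≤ suc (double b) → a ≤ b
double-≤-cancel zero    b       _               = z≤n
double-≤-cancel (suc a) (suc b) (s≤s (s≤s p)) = s≤s (double-≤-cancel a b p)

double-<-cancel : ∀ a b → suc (double a) ≤ double b → a < b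
double-<-cancel zero    (suc b) _               = s≤s z≤n
double-<-cancel (suc a) (suc b) (s≤s (s≤s p)) = s≤s (double-<-cancel a b p)

module _ {k l : ℕ} where

  -- Every extended letter e occupies the interval [lower e, upper e] of
  -- doubled ranks: upper e = 2·rank e + 1, and lower e is 2·rank e for
  -- primed letters and 2·rank e + 1 otherwise.
  lower : Ext k l → ℕ
  lower (lt (un a)) = suc (double (toℕ a))
  lower (lt (pr b)) = double (k + toℕ b)
  lower ∞           = suc (double (k + l))

  upper : Ext k l → ℕ
  upper e = suc (double (rank e))

  -- a ≺ b means "a < b, or a = b is primed": the order of the first column
  -- (strict on unprimed, weak on primed entries), and the order in which a
  -- letter x must lie below the entry it bumps.
  record _≺_ (a b : Ext k l) : Set where
    constructor mk≺
    field ≺-keys : lower a < upper b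

  -- a ⪯ b means "a < b, or a = b is unprimed": the order along rows, and the
  -- order in which the left neighbour of a bumped entry must lie below x.
  record _⪯_ (a b : Ext k l) : Set where
    constructor mk⪯
    field ⪯-keys : upper a ≤ lower b

  lower≤upper : ∀ e → lower e ≤ upper e
  lower≤upper (lt (un a)) = ≤-refl
  lower≤upper (lt (pr b)) = n≤1+n _
  lower≤upper ∞           = ≤-refl

  upper≤1+lower : ∀ e → upper e ≤ suc (lower e)
  upper≤1+lower (lt (un a)) = n≤1+n _
  upper≤1+lower (lt (pr b)) = ≤-refl
  upper≤1+lower ∞           = n≤1+n _

  double-rank≤lower : ∀ e → double (rank e) ≤ lower e
  double-rank≤lower (lt (un a)) = n≤1+n _
  double-rank≤lower (lt (pr b)) = ≤-refl
  double-rank≤lower ∞           = n≤1+n _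

  rank≤k+l : ∀ (e : Ext k l) → rank e ≤ k + l
  rank≤k+l (lt (un a)) = ≤-trans (<⇒≤ (toℕ<n a)) (m≤m+n k l)
  rank≤k+l (lt (pr b)) = +-monoʳ-≤ k (<⇒≤ (toℕ<n b))
  rank≤k+l ∞           = ≤-refl

  letter-rank<k+l : ∀ (x : Letter k l) → rank {k} {l} (lt x) < k + l
  letter-rank<k+l (un a) = <-≤-trans (toℕ<n a) (m≤m+n k l)
  letter-rank<k+l (pr b) = +-monoʳ-< k (toℕ<n b)

  unprimed-rank<k : ∀ {e : Ext k l} → Unprimed e → rank e < k
  unprimed-rank<k (isUn a) = toℕ<n a

  primed-k≤rank : ∀ {e : Ext k l} → Primed e → k ≤ rank e
  primed-k≤rank (isPr b) = m≤m+n k (toℕ b)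

  unprimed<primed : ∀ {a b : Ext k l} → Unprimed a → Primed b → rank a < rank b
  unprimed<primed ua pb = <-≤-trans (unprimed-rank<k ua) (primed-k≤rank pb)

  ≺-trans : ∀ {a b c} → a ≺ b → b ≺ c → a ≺ c
  ≺-trans {b = b} (mk≺ p) (mk≺ q) = mk≺ (≤-<-trans (≤-pred (≤-trans p (upper≤1+lower b))) q)

  ⪯-trans : ∀ {a b c} → a ⪯ b → b ⪯ c → a ⪯ c
  ⪯-trans {b = b} (mk⪯ p) (mk⪯ q) = mk⪯ (≤-trans p (≤-trans (lower≤upper b) q))

  ⪯-≺-trans : ∀ {a b c} → a ⪯ b → b ≺ c → a ≺ c
  ⪯-≺-trans {a} (mk⪯ p) (mk≺ q) = mk≺ (≤-<-trans (≤-trans (lower≤upper a) p) q)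

  ≺-⪯-weaken : ∀ {a b c} → a ≺ b → b ⪯ c → a ⪯ c
  ≺-⪯-weaken {a} (mk≺ p) (mk⪯ q) = mk⪯ (≤-trans (upper≤1+lower a) (≤-trans p q))

  ≺-⪯-asym : ∀ {a b} → a ≺ b → b ⪯ a → ⊥
  ≺-⪯-asym (mk≺ p) (mk⪯ q) = <⇒≱ p q

  ⋠⇒≺ : ∀ {a b} → ¬ (a ⪯ b) → b ≺ a
  ⋠⇒≺ p = mk≺ (≰⇒> λ q → p (mk⪯ q))

  rank<⇒≺ : ∀ {a b : Ext k l} → rank a < rank b → a ≺ b
  rank<⇒≺ {a} p = mk≺ (s≤s (≤-trans (lower≤upper a) (≤-trans (n≤1+n _) (double-gap p))))

  rank<⇒⪯ : ∀ {a b : Ext k l} → rank a < rank b → a ⪯ b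
  rank<⇒⪯ {b = b} p = mk⪯ (≤-trans (n≤1+n _) (≤-trans (double-gap p) (double-rank≤lower b)))

  ≺∞ : ∀ {e : Ext k l} → e ≢ ∞ → e ≺ ∞
  ≺∞ {lt x} _ = rank<⇒≺ (letter-rank<k+l x)
  ≺∞ {∞}    h = ⊥-elim (h refl)

  ∞⊀ : ∀ {e : Ext k l} → ¬ (∞ ≺ e)
  ∞⊀ {e} (mk≺ p) = <⇒≱ (double-<-cancel (k + l) (rank e) (≤-pred p)) (rank≤k+l e)

  ∞⋠ : ∀ {x : Letter k l} → ¬ (∞ ⪯ lt x)
  ∞⋠ {x} (mk⪯ p) = <⇒≱ (letter-rank<k+l x)
    (double-≤-cancel (k + l) _ (≤-trans (n≤1+n _) (≤-trans p (lower≤upper (lt x)))))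

  primed-≺ : ∀ {a b : Ext k l} → Primed a → rank a ≤ rank b → a ≺ b
  primed-≺ (isPr _) p = mk≺ (s≤s (double-mono p))

  ⪯-unprimed : ∀ {a b : Ext k l} → Unprimed b → rank a ≤ rank b → a ⪯ b
  ⪯-unprimed (isUn _) p = mk⪯ (s≤s (double-mono p))

  ≺⇒rank≤ : ∀ {a b : Ext k l} → a ≺ b → rank a ≤ rank b
  ≺⇒rank≤ {a} {b} (mk≺ p) =
    double-≤-cancel _ _ (≤-trans (double-rank≤lower a) (≤-trans (≤-pred p) (n≤1+n _)))

  ⪯⇒rank≤ : ∀ {a b : Ext k l} → a ⪯ b → rank a ≤ rank b
  ⪯⇒rank≤ {a} {b} (mk⪯ p) =
    double-≤-cancel _ _ (≤-trans (n≤1+n _) (≤-trans p (lower≤upper b)))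

  unprimed-≺⇒rank< : ∀ {a b : Ext k l} → Unprimed a → a ≺ b → rank a < rank b
  unprimed-≺⇒rank< (isUn _) (mk≺ p) = double-<-cancel _ _ (≤-pred p)

  ⪯-primed⇒rank< : ∀ {a b : Ext k l} → Primed b → a ⪯ b → rank a < rank b
  ⪯-primed⇒rank< (isPr _) (mk⪯ p) = double-<-cancel _ _ p

  ≺-unprimed⇒rank< : ∀ {a b : Ext k l} → Unprimed b → a ≺ b → rank a < rank b
  ≺-unprimed⇒rank< {lt (un q)} ub p = unprimed-≺⇒rank< (isUn q) p
  ≺-unprimed⇒rank< {lt (pr q)} ub p = ⊥-elim (<⇒≱ (unprimed<primed ub (isPr q)) (≺⇒rank≤ p))
  ≺-unprimed⇒rank< {∞}         ub p = ⊥-elim (∞⊀ p)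

  ≺-primed : ∀ {a b : Ext k l} → Primed b → rank a ≤ rank b → a ≺ b
  ≺-primed {lt (un q)} pb p = rank<⇒≺ (unprimed<primed (isUn q) pb)
  ≺-primed {lt (pr q)} pb p = primed-≺ (isPr q) p
  ≺-primed {∞} {lt x} pb p  = ⊥-elim (<⇒≱ (letter-rank<k+l x) p)

  rank⇒⪯ : ∀ {a b : Ext k l} → b ≢ ∞ → rank a ≤ rank b →
           (Primed a → Primed b → rank a < rank b) → a ⪯ b
  rank⇒⪯ {b = lt (un q)} _ p _ = ⪯-unprimed (isUn q) p
  rank⇒⪯ {lt (un a)} {lt (pr q)} _ _ _ = rank<⇒⪯ (unprimed<primed (isUn a) (isPr q))
  rank⇒⪯ {lt (pr a)} {lt (pr q)} _ _ s = rank<⇒⪯ (s (isPr a) (isPr q))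
  rank⇒⪯ {∞} {lt (pr q)} _ p _ = ⊥-elim (<⇒≱ (letter-rank<k+l (pr q)) p)
  rank⇒⪯ {b = ∞} h _ _ = ⊥-elim (h refl)

  rank⇒≺ : ∀ {a b : Ext k l} → b ≢ ∞ → rank a ≤ rank b →
           (Unprimed a → Unprimed b → rank a < rank b) → a ≺ b
  rank⇒≺ {lt (pr a)} _ p _ = primed-≺ (isPr a) p
  rank⇒≺ {lt (un a)} {lt (un q)} _ _ s = rank<⇒≺ (s (isUn a) (isUn q))
  rank⇒≺ {lt (un a)} {lt (pr q)} _ _ _ = rank<⇒≺ (unprimed<primed (isUn a) (isPr q))
  rank⇒≺ {∞} {lt y} _ p _ = ⊥-elim (<⇒≱ (letter-rank<k+l y) p)
  rank⇒≺ {b = ∞} h _ _ = ⊥-elim (h refl)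

  -- The paper's triple conditions (a),(b) for a letter a in column n+1, with b
  -- and c in columns n, n+1 of a higher row, amount to: a ≺ b or c ≺ a.
  triple⇒≺ : ∀ {a b c : Ext k l} → a ≢ ∞ →
    (Unprimed a → rank b ≤ rank a → rank c < rank a) →
    (Primed a → rank b < rank a → rank c ≤ rank a) →
    a ≺ b ⊎ c ≺ a
  triple⇒≺ {lt (un p)} {b} _ A _ with rank b ≤? toℕ p
  ... | yes q = inj₂ (rank<⇒≺ (A (isUn p) q))
  ... | no q  = inj₁ (rank<⇒≺ (≰⇒> q))
  triple⇒≺ {lt (pr p)} {b} _ _ B with rank b <? rank {k} {l} (lt (pr p))
  ... | yes q = inj₂ (≺-primed (isPr p) (B (isPr p) q))
  ... | no q  = inj₁ (primed-≺ (isPr p) (≮⇒≥ q))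
  triple⇒≺ {∞} h _ _ = ⊥-elim (h refl)

  ≺⇒tripleA : ∀ {a b c : Ext k l} → a ≺ b ⊎ c ≺ a → Unprimed a → rank b ≤ rank a → rank c < rank a
  ≺⇒tripleA (inj₁ ab) ua ba = ⊥-elim (<⇒≱ (unprimed-≺⇒rank< ua ab) ba)
  ≺⇒tripleA (inj₂ ca) ua _  = ≺-unprimed⇒rank< ua ca

  ≺⇒tripleB : ∀ {a b c : Ext k l} → a ≺ b ⊎ c ≺ a → Primed a → rank b < rank a → rank c ≤ rank a
  ≺⇒tripleB (inj₁ ab) _ ba = ⊥-elim (<⇒≱ ba (≺⇒rank≤ ab))
  ≺⇒tripleB (inj₂ ca) _ _  = ≺⇒rank≤ ca

  bumps-sound : ∀ (x : Letter k l) cur left → T (bumps x cur left) → lt x ≺ cur × left ⪯ lt x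
  bumps-sound (un a) cur left t with Equivalence.to T-∧ t
  ... | p , q = rank<⇒≺ (<ᵇ⇒< _ _ p) , ⪯-unprimed (isUn a) (≤ᵇ⇒≤ _ _ q)
  bumps-sound (pr b) cur left t with Equivalence.to T-∧ t
  ... | p , q = primed-≺ (isPr b) (≤ᵇ⇒≤ _ _ p) , rank<⇒⪯ (<ᵇ⇒< _ _ q)

  bumps-complete : ∀ (x : Letter k l) cur left → lt x ≺ cur → left ⪯ lt x → T (bumps x cur left)
  bumps-complete (un a) cur left p q =
    Equivalence.from T-∧ (<⇒<ᵇ (unprimed-≺⇒rank< (isUn a) p) , ≤⇒≤ᵇ (⪯⇒rank≤ q))
  bumps-complete (pr b) cur left p q =
    Equivalence.from T-∧ (≤⇒≤ᵇ (≺⇒rank≤ p) , <⇒<ᵇ (⪯-primed⇒rank< (isPr b) q))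

  ≡letter⇒≢∞ : ∀ {a : Ext k l} {x : Letter k l} → a ≡ lt x → a ≢ ∞
  ≡letter⇒≢∞ refl ()

  ≺letter⇒≢∞ : ∀ {a : Ext k l} {x : Letter k l} → a ≺ lt x → a ≢ ∞
  ≺letter⇒≢∞ p refl = ∞⊀ p

  ⪯letter⇒≢∞ : ∀ {a : Ext k l} {x : Letter k l} → a ⪯ lt x → a ≢ ∞
  ⪯letter⇒≢∞ p refl = ∞⋠ p

  -- If a ≺ y although y has rank at most that of a, then y is primed of the
  -- same rank, so y ≺ a as well.
  ≺-flip : ∀ {a : Ext k l} {y : Letter k l} → a ≺ lt y → rank (lt y) ≤ rank a → lt y ≺ a
  ≺-flip {y = un q} p r = ⊥-elim (<⇒≱ (≺-unprimed⇒rank< (isUn q) p) r)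
  ≺-flip {y = pr q} p r = primed-≺ (isPr q) r

module _ {k l : ℕ} where

  entryRow-∞-right : ∀ (row : List (Letter k l)) j → entryRow row j ≡ ∞ → entryRow row (suc j) ≡ ∞
  entryRow-∞-right []        j       _ = refl
  entryRow-∞-right (x ∷ row) (suc j) e = entryRow-∞-right row j e

  hat-left-defined : ∀ (F : Filling k l) i j → hat F i (suc j) ≢ ∞ → hat F i j ≢ ∞
  hat-left-defined []       i       j h _ = h refl
  hat-left-defined (r ∷ F) zero    j h e = h (entryRow-∞-right r j e)
  hat-left-defined (r ∷ F) (suc i) j h e = hat-left-defined F i j h e

  entryRow-defined : ∀ (row : List (Letter k l)) j → entryRow row j ≢ ∞ → j < length row
  entryRow-defined []        j       h = ⊥-elim (h refl)
  entryRow-defined (x ∷ row) zero    h = s≤s z≤n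
  entryRow-defined (x ∷ row) (suc j) h = s≤s (entryRow-defined row j h)

  hat-defined : ∀ (F : Filling k l) i j → hat F i j ≢ ∞ → i < numRows F × j < rowLen F i
  hat-defined []       i       j h = ⊥-elim (h refl)
  hat-defined (r ∷ F) zero    j h = s≤s z≤n , entryRow-defined r j h
  hat-defined (r ∷ F) (suc i) j h with hat-defined F i j h
  ... | p , q = s≤s p , q

  hat-inside : ∀ (F : Filling k l) i j → i < numRows F → j < rowLen F i → hat F i j ≢ ∞
  hat-inside (r ∷ F) zero    j _ q = inside r j q
    where
    inside : ∀ (row : List (Letter k l)) j → j < length row → entryRow row j ≢ ∞
    inside (x ∷ row) zero    _       ()
    inside (x ∷ row) (suc j) (s≤s p) = inside row j p
  hat-inside (r ∷ F) (suc i) j (s≤s p) q = hat-inside F i j p q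

  hat-above-top : ∀ (F : Filling k l) i j → numRows F ≤ i → hat F i j ≡ ∞
  hat-above-top []       i       j _       = refl
  hat-above-top (r ∷ F) (suc i) j (s≤s p) = hat-above-top F i j p

  rowLen≤maxLen : ∀ (F : Filling k l) i → rowLen F i ≤ maxLen F
  rowLen≤maxLen []       i       = z≤n
  rowLen≤maxLen (r ∷ F) zero    = m≤m⊔n _ _
  rowLen≤maxLen (r ∷ F) (suc i) = ≤-trans (rowLen≤maxLen F i) (m≤n⊔m (length r) _)

  hat-beyond-row : ∀ (F : Filling k l) i j → rowLen F i ≤ j → hat F i j ≡ ∞
  hat-beyond-row []       i       j       _       = refl
  hat-beyond-row ([] ∷ F) zero    j       _       = refl
  hat-beyond-row ((x ∷ r) ∷ F) zero (suc j) (s≤s p) = hat-beyond-row (r ∷ F) zero j p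
  hat-beyond-row (r ∷ F)  (suc i) j       p       = hat-beyond-row F i j p

  hat-beyond-maxLen : ∀ (F : Filling k l) i → hat F i (maxLen F) ≡ ∞
  hat-beyond-maxLen F i = hat-beyond-row F i (maxLen F) (rowLen≤maxLen F i)

  setCell-numRows : ∀ (F : Filling k l) i j x → numRows (setCell F i j x) ≡ numRows F
  setCell-numRows []      i       j x = refl
  setCell-numRows (r ∷ F) zero    j x = refl
  setCell-numRows (r ∷ F) (suc i) j x = cong suc (setCell-numRows F i j x)

  setCell-hit : ∀ (F : Filling k l) i j x → hat F i j ≢ ∞ → hat (setCell F i (suc j) x) i (suc j) ≡ lt x
  setCell-hit []      i       j x h = ⊥-elim (h refl)
  setCell-hit (r ∷ F) zero    j x h = setRow-hit r j (entryRow-defined r j h)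
    where
    setRow-hit : ∀ (row : List (Letter k l)) j → j < length row → entryRow (setRow row (suc j) x) (suc j) ≡ lt x
    setRow-hit (y ∷ [])      zero    _       = refl
    setRow-hit (y ∷ z ∷ row) zero    _       = refl
    setRow-hit (y ∷ row)     (suc j) (s≤s p) = setRow-hit row j p
  setCell-hit (r ∷ F) (suc i) j x h = setCell-hit F i j x h

  setCell-miss : ∀ (F : Filling k l) i j x i′ j′ → i′ ≢ i ⊎ j′ ≢ j → hat (setCell F i j x) i′ j′ ≡ hat F i′ j′
  setCell-miss []      i       j x i′       j′ _ = refl
  setCell-miss (r ∷ F) zero    j x zero     j′ (inj₁ h) = ⊥-elim (h refl)
  setCell-miss (r ∷ F) zero    j x zero     j′ (inj₂ h) = setRow-miss r j j′ h
    where
    setRow-miss : ∀ (row : List (Letter k l)) j j′ → j′ ≢ j → entryRow (setRow row j x) j′ ≡ entryRow row j′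
    setRow-miss []        zero    zero     h = ⊥-elim (h refl)
    setRow-miss []        zero    (suc j′) h = refl
    setRow-miss []        (suc j) j′       h = refl
    setRow-miss (y ∷ row) zero    zero     h = ⊥-elim (h refl)
    setRow-miss (y ∷ row) zero    (suc j′) h = refl
    setRow-miss (y ∷ row) (suc j) zero     h = refl
    setRow-miss (y ∷ row) (suc j) (suc j′) h = setRow-miss row j j′ (λ e → h (cong suc e))
  setCell-miss (r ∷ F) zero    j x (suc i′) j′ _ = refl
  setCell-miss (r ∷ F) (suc i) j x zero     j′ _ = refl
  setCell-miss (r ∷ F) (suc i) j x (suc i′) j′ (inj₁ h) = setCell-miss F i j x i′ j′ (inj₁ λ e → h (cong suc e))
  setCell-miss (r ∷ F) (suc i) j x (suc i′) j′ (inj₂ h) = setCell-miss F i j x i′ j′ (inj₂ h)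

module _ {k l : ℕ} where

  -- The local form of a hook composition tableau: only adjacent cells are
  -- compared, and the rank conditions are expressed by the orders ⪯ (rows),
  -- ≺ (first column) and "a ≺ b or c ≺ a" (triples).  Cells outside the
  -- diagram are ∞, so rows and columns need no explicit bounds.
  record LocalHCT (F : Filling k l) : Set where
    field
      firstCol : ∀ i → i < numRows F → hat F i 0 ≢ ∞
      rowStep  : ∀ i j → hat F i (suc j) ≢ ∞ → hat F i j ⪯ hat F i (suc j)
      colStep  : ∀ i → hat F (suc i) 0 ≢ ∞ → hat F i 0 ≺ hat F (suc i) 0
      triple   : ∀ i j n → i < j → hat F i (suc n) ≢ ∞ →
                 hat F i (suc n) ≺ hat F j n ⊎ hat F j (suc n) ≺ hat F i (suc n)

  isHCT⇒local : ∀ (F : Filling k l) → IsHCT F → LocalHCT F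
  isHCT⇒local F H = record
    { firstCol = λ i p → hat-inside F i 0 p (composition i p)
    ; rowStep  = rowStep
    ; colStep  = colStep
    ; triple   = triple
    }
    where
    open IsHCT H
    rowStep : ∀ i j → hat F i (suc j) ≢ ∞ → hat F i j ⪯ hat F i (suc j)
    rowStep i j h with hat-defined F i (suc j) h
    ... | p , q = rank⇒⪯ h (rowWeak i j (suc j) p ≤-refl q) (rowPrimedStrict i j (suc j) p ≤-refl q)
    colStep : ∀ i → hat F (suc i) 0 ≢ ∞ → hat F i 0 ≺ hat F (suc i) 0
    colStep i h with hat-defined F (suc i) 0 h
    ... | p , _ = rank⇒≺ h (colWeak i (suc i) ≤-refl p) (colUnprimedStrict i (suc i) ≤-refl p)
    -- a higher row outside the diagram consists of ∞, which lies above every letter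
    triple : ∀ i j n → i < j → hat F i (suc n) ≢ ∞ →
             hat F i (suc n) ≺ hat F j n ⊎ hat F j (suc n) ≺ hat F i (suc n)
    triple i j n p h with j <? numRows F
    ... | no q  rewrite hat-above-top F j n (≮⇒≥ q) = inj₁ (≺∞ h)
    ... | yes q = triple⇒≺ h (tripleA i j n p q n+1<m) (tripleB i j n p q n+1<m)
      where
      n+1<m : suc n < maxLen F
      n+1<m = <-≤-trans (proj₂ (hat-defined F i (suc n) h)) (rowLen≤maxLen F i)

  rowChain : ∀ {F : Filling k l} → LocalHCT F → ∀ i j j′ → j < j′ → hat F i j′ ≢ ∞ → hat F i j ⪯ hat F i j′
  rowChain {F} H i j (suc j′) p h with m<1+n⇒m<n∨m≡n p
  ... | inj₂ refl = LocalHCT.rowStep H i j h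
  ... | inj₁ q    = ⪯-trans (rowChain H i j j′ q (hat-left-defined F i j′ h)) (LocalHCT.rowStep H i j′ h)

  colChain : ∀ {F : Filling k l} → LocalHCT F → ∀ i i′ → i < i′ → i′ < numRows F → hat F i 0 ≺ hat F i′ 0
  colChain H i (suc i′) p q with m<1+n⇒m<n∨m≡n p
  ... | inj₂ refl = LocalHCT.colStep H i (LocalHCT.firstCol H (suc i) q)
  ... | inj₁ r    = ≺-trans (colChain H i i′ r (<-trans (n<1+n i′) q))
                            (LocalHCT.colStep H i′ (LocalHCT.firstCol H (suc i′) q))

  local⇒isHCT : ∀ (F : Filling k l) → LocalHCT F → IsHCT F
  local⇒isHCT F H = record
    { composition       = λ i p → proj₂ (hat-defined F i 0 (firstCol i p))
    ; rowWeak           = λ i j j′ p q r → ⪯⇒rank≤ (row i j j′ p q r)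
    ; rowPrimedStrict   = λ i j j′ p q r _ pb → ⪯-primed⇒rank< pb (row i j j′ p q r)
    ; colWeak           = λ i i′ p q → ≺⇒rank≤ (colChain H i i′ p q)
    ; colUnprimedStrict = λ i i′ p q ua _ → unprimed-≺⇒rank< ua (colChain H i i′ p q)
    ; tripleA           = λ i j n p _ _ ua → ≺⇒tripleA (triple i j n p (unprimed≢∞ ua)) ua
    ; tripleB           = λ i j n p _ _ pa → ≺⇒tripleB (triple i j n p (primed≢∞ pa)) pa
    }
    where
    open LocalHCT H
    row : ∀ i j j′ → i < numRows F → j < j′ → j′ < rowLen F i → hat F i j ⪯ hat F i j′
    row i j j′ p q r = rowChain H i j j′ q (hat-inside F i j′ p r)
    unprimed≢∞ : ∀ {e : Ext k l} → Unprimed e → e ≢ ∞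
    unprimed≢∞ (isUn _) ()
    primed≢∞ : ∀ {e : Ext k l} → Primed e → e ≢ ∞
    primed≢∞ (isPr _) ()

module _ {k l : ℕ} where

  -- For x placed in
  -- column c+1 of a lower row this is exactly its triple condition against row i.
  Separates : Filling k l → Letter k l → ℕ → ℕ → Set
  Separates G x i c = lt x ≺ hat G i c ⊎ hat G i (suc c) ≺ lt x

  -- The triple condition above a bumped cell.  Row i₁ holds g ⪯ a in columns
  -- c+1, c+2; a higher row holds f, y, z in columns c, c+1, c+2, and x replaces
  -- y (so f ⪯ x).  If x separates (g , a), the old triples (g ; f , y) and
  -- (a ; y , z) give the new triple (a ; x , z).
  triple-above-bump : ∀ {x f y z g a : Ext k l} →
    x ≺ g ⊎ a ≺ x → f ⪯ x → g ≺ f ⊎ y ≺ g → a ≺ y ⊎ z ≺ a → g ⪯ a → a ≺ x ⊎ z ≺ a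
  triple-above-bump (inj₂ a≺x) _ _ _ _ = inj₁ a≺x
  triple-above-bump (inj₁ x≺g) f⪯x (inj₁ g≺f) _ _ = ⊥-elim (≺-⪯-asym (≺-trans x≺g g≺f) f⪯x)
  triple-above-bump (inj₁ x≺g) f⪯x (inj₂ y≺g) (inj₁ a≺y) g⪯a = ⊥-elim (≺-⪯-asym (≺-trans a≺y y≺g) g⪯a)
  triple-above-bump (inj₁ x≺g) f⪯x (inj₂ y≺g) (inj₂ z≺a) g⪯a = inj₂ z≺a

  -- The first column and
  -- all rows but row i are untouched; row i stays a row by the bump condition.
  module Bump {G : Filling k l} (H : LocalHCT G) (i c : ℕ) (x : Letter k l)
              (x≺cur : lt x ≺ hat G i (suc c)) (left⪯x : hat G i c ⪯ lt x) where
    open LocalHCT H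

    G′ : Filling k l
    G′ = setCell G i (suc c) x

    hit : hat G′ i (suc c) ≡ lt x
    hit = setCell-hit G i c x (⪯letter⇒≢∞ left⪯x)

    miss : ∀ i′ j′ → i′ ≢ i ⊎ j′ ≢ suc c → hat G′ i′ j′ ≡ hat G i′ j′
    miss = setCell-miss G i (suc c) x

    firstCol′ : ∀ i′ → i′ < numRows G′ → hat G′ i′ 0 ≢ ∞
    firstCol′ i′ p rewrite miss i′ 0 (inj₂ λ ()) = firstCol i′ (subst (i′ <_) (setCell-numRows G i (suc c) x) p)

    colStep′ : ∀ i′ → hat G′ (suc i′) 0 ≢ ∞ → hat G′ i′ 0 ≺ hat G′ (suc i′) 0
    colStep′ i′ rewrite miss i′ 0 (inj₂ λ ()) | miss (suc i′) 0 (inj₂ λ ()) = colStep i′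

    rowStep′ : ∀ i′ j → hat G′ i′ (suc j) ≢ ∞ → hat G′ i′ j ⪯ hat G′ i′ (suc j)
    rowStep′ i′ j h with i′ ≟ i
    ... | no i′≢i rewrite miss i′ j (inj₁ i′≢i) | miss i′ (suc j) (inj₁ i′≢i) = rowStep i′ j h
    ... | yes refl with j ≟ c | j ≟ suc c
    ...   | yes refl | _ rewrite hit | miss i c (inj₂ λ e → 1+n≢n (sym e)) = left⪯x
    ...   | no _ | yes refl rewrite hit | miss i (suc (suc c)) (inj₂ 1+n≢n) = ≺-⪯-weaken x≺cur (rowStep i (suc c) h)
    ...   | no j≢c | no j≢c+1 rewrite miss i j (inj₂ j≢c+1) | miss i (suc j) (inj₂ λ e → j≢c (suc-injective e)) =
              rowStep i j h

    triple′ : (∀ j → i < j → Separates G x j c) → (∀ i′ → i′ < i → Separates G x i′ (suc c)) →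
              ∀ i₁ j₁ n → i₁ < j₁ → hat G′ i₁ (suc n) ≢ ∞ →
              hat G′ i₁ (suc n) ≺ hat G′ j₁ n ⊎ hat G′ j₁ (suc n) ≺ hat G′ i₁ (suc n)
    triple′ above below i₁ j₁ n i₁<j₁ h with i₁ ≟ i | j₁ ≟ i
    ... | yes refl | yes refl = ⊥-elim (<-irrefl refl i₁<j₁)
    -- the written cell is the top-right entry of the triple
    ... | yes refl | no j₁≢i with n ≟ c
    ...   | yes refl rewrite hit | miss j₁ c (inj₁ j₁≢i) | miss j₁ (suc c) (inj₁ j₁≢i) = above j₁ i₁<j₁
    ...   | no n≢c rewrite miss i (suc n) (inj₂ λ e → n≢c (suc-injective e)) | miss j₁ n (inj₁ j₁≢i)
                         | miss j₁ (suc n) (inj₁ j₁≢i) = triple i j₁ n i₁<j₁ h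
    -- the written cell lies in the higher row of the triple
    triple′ above below i₁ j₁ n i₁<j₁ h | no i₁≢i | yes refl with n ≟ suc c | n ≟ c
    ...   | yes refl | _ rewrite hit | miss i₁ (suc (suc c)) (inj₁ i₁≢i) | miss i (suc (suc c)) (inj₂ 1+n≢n) =
              triple-above-bump (below i₁ i₁<j₁) left⪯x (triple i₁ i c i₁<j₁ (hat-left-defined G i₁ (suc c) h))
                                (triple i₁ i (suc c) i₁<j₁ h) (rowStep i₁ (suc c) h)
    ...   | no _ | yes refl rewrite hit | miss i₁ (suc c) (inj₁ i₁≢i) | miss i c (inj₂ λ e → 1+n≢n (sym e))
              with triple i₁ i c i₁<j₁ h
    ...     | inj₁ g≺f = inj₁ g≺f
    ...     | inj₂ y≺g = inj₂ (≺-trans x≺cur y≺g)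
    triple′ above below i₁ j₁ n i₁<j₁ h | no i₁≢i | yes refl | no n≢c+1 | no n≢c
      rewrite miss i₁ (suc n) (inj₁ i₁≢i) | miss i n (inj₂ n≢c+1) | miss i (suc n) (inj₂ λ e → n≢c (suc-injective e)) =
        triple i₁ i n i₁<j₁ h
    triple′ above below i₁ j₁ n i₁<j₁ h | no i₁≢i | no j₁≢i
      rewrite miss i₁ (suc n) (inj₁ i₁≢i) | miss j₁ n (inj₁ j₁≢i) | miss j₁ (suc n) (inj₁ j₁≢i) =
        triple i₁ j₁ n i₁<j₁ h

  bump-local : ∀ {G : Filling k l} → LocalHCT G → ∀ i c x →
    lt x ≺ hat G i (suc c) → hat G i c ⪯ lt x →
    (∀ j → i < j → Separates G x j c) →
    (∀ i′ → i′ < i → Separates G x i′ (suc c)) →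
    LocalHCT (setCell G i (suc c) x)
  bump-local H i c x x≺cur left⪯x above below = record
    { firstCol = firstCol′
    ; rowStep  = rowStep′
    ; colStep  = colStep′
    ; triple   = triple′ above below
    }
    where open Bump H i c x x≺cur left⪯x

module _ {k l : ℕ} where

  local-nil : LocalHCT {k} {l} []
  local-nil = record
    { firstCol = λ _ ()
    ; rowStep  = λ _ _ h → ⊥-elim (h refl)
    ; colStep  = λ _ h → ⊥-elim (h refl)
    ; triple   = λ _ _ _ _ h → ⊥-elim (h refl)
    }

  local-tail : ∀ {R : List (Letter k l)} {Rs} → LocalHCT (R ∷ Rs) → LocalHCT Rs
  local-tail H = record
    { firstCol = λ i p → firstCol (suc i) (s≤s p)
    ; rowStep  = λ i → rowStep (suc i)
    ; colStep  = λ i → colStep (suc i)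
    ; triple   = λ i j n p → triple (suc i) (suc j) n (s≤s p)
    }
    where open LocalHCT H

  local-cons : ∀ (R : List (Letter k l)) Rs → LocalHCT Rs →
    entryRow R 0 ≢ ∞ →
    (∀ j → entryRow R (suc j) ≢ ∞ → entryRow R j ⪯ entryRow R (suc j)) →
    (hat Rs 0 0 ≢ ∞ → entryRow R 0 ≺ hat Rs 0 0) →
    (∀ j n → entryRow R (suc n) ≢ ∞ →
       entryRow R (suc n) ≺ hat Rs j n ⊎ hat Rs j (suc n) ≺ entryRow R (suc n)) →
    LocalHCT (R ∷ Rs)
  local-cons R Rs H first row col tri = record
    { firstCol = λ where zero _ → first ; (suc i) (s≤s p) → firstCol i p
    ; rowStep  = λ where zero → row ; (suc i) → rowStep i
    ; colStep  = λ where zero → col ; (suc i) → colStep i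
    ; triple   = λ where zero (suc j) n _ → tri j n ; (suc i) (suc j) n (s≤s p) → triple i j n p
    }
    where open LocalHCT H

  newRow-bottom : ∀ (x : Letter k l) Rs → hat (newRow x Rs) 0 0 ≡ lt x ⊎ hat (newRow x Rs) 0 0 ≡ hat Rs 0 0
  newRow-bottom x []       = inj₁ refl
  newRow-bottom x (R ∷ Rs) with rank (entryRow R 0) <ᵇ rank {k} {l} (lt x)
  ... | true  = inj₂ refl
  ... | false = inj₁ refl

  newRow-row : ∀ (x : Letter k l) Rs j →
    (∀ n → hat (newRow x Rs) j n ≡ entryRow (x ∷ []) n) ⊎ ∃ λ j′ → ∀ n → hat (newRow x Rs) j n ≡ hat Rs j′ n
  newRow-row x []       zero    = inj₁ λ _ → refl
  newRow-row x []       (suc j) = inj₂ (0 , λ _ → refl)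
  newRow-row x (R ∷ Rs) j with rank (entryRow R 0) <ᵇ rank {k} {l} (lt x)
  newRow-row x (R ∷ Rs) zero    | true  = inj₂ (0 , λ _ → refl)
  newRow-row x (R ∷ Rs) (suc j) | true  with newRow-row x Rs j
  ... | inj₁ p        = inj₁ p
  ... | inj₂ (j′ , p) = inj₂ (suc j′ , p)
  newRow-row x (R ∷ Rs) zero    | false = inj₁ λ _ → refl
  newRow-row x (R ∷ Rs) (suc j) | false = inj₂ (j , λ _ → refl)

  <ᵇ-true : ∀ {m n} → (m <ᵇ n) ≡ true → m < n
  <ᵇ-true e = <ᵇ⇒< _ _ (Equivalence.from T-≡ e)

  <ᵇ-false : ∀ {m n} → (m <ᵇ n) ≡ false → n ≤ m
  <ᵇ-false e = ≮⇒≥ λ p → subst T e (<⇒<ᵇ p)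

  newRow-local : ∀ (G : Filling k l) x → LocalHCT G → (∀ i → Separates G x i 0) → LocalHCT (newRow x G)
  newRow-local [] x _ _ =
    local-cons (x ∷ []) [] local-nil (λ ()) (λ _ h → ⊥-elim (h refl)) (λ h → ⊥-elim (h refl)) (λ _ _ h → ⊥-elim (h refl))
  newRow-local (R ∷ Rs) x H sep with rank (entryRow R 0) <ᵇ rank {k} {l} (lt x) in e
  ... | true = local-cons R (newRow x Rs) (newRow-local Rs x (local-tail H) (λ i → sep (suc i)))
                 (firstCol 0 (s≤s z≤n)) (rowStep 0) col tri
    where
    open LocalHCT H
    R₀<x : rank (entryRow R 0) < rank {k} {l} (lt x)
    R₀<x = <ᵇ-true e
    col : hat (newRow x Rs) 0 0 ≢ ∞ → entryRow R 0 ≺ hat (newRow x Rs) 0 0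
    col h with newRow-bottom x Rs
    ... | inj₁ q rewrite q = rank<⇒≺ R₀<x
    ... | inj₂ q rewrite q = colStep 0 h
    tri : ∀ j n → entryRow R (suc n) ≢ ∞ →
          entryRow R (suc n) ≺ hat (newRow x Rs) j n ⊎ hat (newRow x Rs) j (suc n) ≺ entryRow R (suc n)
    tri j n h with newRow-row x Rs j
    ... | inj₂ (j′ , q) rewrite q n | q (suc n) = triple 0 (suc j′) n (s≤s z≤n) h
    ... | inj₁ q rewrite q n | q (suc n) with n | sep 0
    ...   | suc _ | _       = inj₁ (≺∞ h)
    ...   | zero  | inj₂ p  = inj₁ p
    ...   | zero  | inj₁ p  = ⊥-elim (<⇒≱ R₀<x (≺⇒rank≤ p))
  ... | false = local-cons (x ∷ []) (R ∷ Rs) H (λ ()) (λ _ h → ⊥-elim (h refl)) col (λ _ _ h → ⊥-elim (h refl))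
    where
    open LocalHCT H
    col : hat (R ∷ Rs) 0 0 ≢ ∞ → lt x ≺ entryRow R 0
    col _ with sep 0
    ... | inj₁ x≺R₀ = x≺R₀
    ... | inj₂ R₁≺x = ≺-flip (⪯-≺-trans (rowStep 0 0 (≺letter⇒≢∞ R₁≺x)) R₁≺x) (<ᵇ-false e)

module _ {k l : ℕ} where

  separates-setCell : ∀ (G : Filling k l) i j x y i′ c → i′ ≢ i →
    Separates G y i′ c → Separates (setCell G i j x) y i′ c
  separates-setCell G i j x y i′ c i′≢i
    rewrite setCell-miss G i j x i′ c (inj₁ i′≢i) | setCell-miss G i j x i′ (suc c) (inj₁ i′≢i) = λ s → s

  unbumped-separates : ∀ {G : Filling k l} → LocalHCT G → ∀ {x i c} →
    ¬ (lt x ≺ hat G i (suc c) × hat G i c ⪯ lt x) → Separates G x i (suc c) → Separates G x i c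
  unbumped-separates H nb (inj₁ x≺cur) = inj₁ (⋠⇒≺ λ left⪯x → nb (x≺cur , left⪯x))
  unbumped-separates H nb (inj₂ right≺x) =
    inj₂ (⪯-≺-trans (LocalHCT.rowStep H _ _ (≺letter⇒≢∞ right≺x)) right≺x)

  -- When x bumps y out of cell (i , c+1), the displaced y separates the pairs
  -- in columns c, c+1 of higher rows (the triple condition at y) and inherits
  -- the separation of the pairs in columns c+1, c+2 of lower rows from x.
  displaced-above : ∀ {G : Filling k l} → LocalHCT G → ∀ {i c y} →
    hat G i (suc c) ≡ lt y → ∀ j → i < j → Separates G y j c
  displaced-above H e j i<j =
    subst (λ a → a ≺ _ ⊎ _ ≺ a) e (LocalHCT.triple H _ j _ i<j (≡letter⇒≢∞ e))

  displaced-below : ∀ {G : Filling k l} → LocalHCT G → ∀ {i c x y} →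
    hat G i (suc c) ≡ lt y → lt x ≺ lt y → hat G i c ⪯ lt x →
    ∀ i′ → i′ < i → Separates G x i′ (suc c) → Separates G y i′ (suc c)
  displaced-below H e x≺y left⪯x i′ i′<i (inj₂ right≺x) = inj₂ (≺-trans right≺x x≺y)
  displaced-below {G} H {c = c} e x≺y left⪯x i′ i′<i (inj₁ x≺cur)
    with hat G i′ (suc c) in cur≡z
  ... | ∞ = inj₁ (≺∞ λ ())
  ... | lt z with LocalHCT.triple H i′ _ c i′<i (≡letter⇒≢∞ cur≡z)
  ...   | inj₁ cur≺left = ⊥-elim (≺-⪯-asym (≺-trans x≺cur (subst (_≺ _) cur≡z cur≺left)) left⪯x)
  ...   | inj₂ y≺cur    = inj₁ (subst₂ (_≺_) e cur≡z y≺cur)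

  -- What the scan of the remaining list of cells needs: a tableau with r rows
  -- and a letter separating the pair in columns c, c+1 of every row.
  Resumable : ℕ → ℕ → List (ℕ × ℕ) → Set
  Resumable r c rest = ∀ (G : Filling k l) x → LocalHCT G → numRows G ≡ r →
    (∀ i → Separates G x i c) → LocalHCT (scan x rest G)

  -- Scanning column c+1 from row n-1 down to row 0.  Invariant: x separates
  -- columns c, c+1 of the rows already passed (j ≥ n) and columns c+1, c+2
  -- of the rows still to come (i < n).
  scan-column : ∀ r c rest → Resumable r c rest →
    ∀ n (G : Filling k l) x → LocalHCT G → numRows G ≡ r →
    (∀ j → n ≤ j → Separates G x j c) → (∀ i → i < n → Separates G x i (suc c)) →
    LocalHCT (scan x (map (λ i → (i , suc c)) (downFrom n) ++ rest) G)
  scan-column r c rest resume zero G x H rows passed _ = resume G x H rows λ j → passed j z≤n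
  scan-column r c rest resume (suc n) G x H rows passed coming
    with bumps x (hat G n (suc c)) (hat G n c) in bumps≡
  ... | false = scan-column r c rest resume n G x H rows passed′ (λ i p → coming i (m<n⇒m<1+n p))
    where
    passed′ : ∀ j → n ≤ j → Separates G x j c
    passed′ j p with m≤n⇒m<n∨m≡n p
    ... | inj₁ n<j  = passed j n<j
    ... | inj₂ refl = unbumped-separates H (λ (x≺cur , left⪯x) → subst T bumps≡ (bumps-complete x _ _ x≺cur left⪯x))
                                          (coming n ≤-refl)
  ... | true with bumps-sound x _ _ (Equivalence.from T-≡ bumps≡) | hat G n (suc c) in cur≡y
  ...   | x≺cur , left⪯x | ∞ =
            bump-local H n c x x≺cur left⪯x passed (λ i p → coming i (m<n⇒m<1+n p))
  ...   | x≺cur , left⪯x | lt y =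
            scan-column r c rest resume n (setCell G n (suc c) x) y bumped
              (trans (setCell-numRows G n (suc c) x) rows) passed′ coming′
    where
    x≺y : lt x ≺ lt y
    x≺y = subst (lt x ≺_) cur≡y x≺cur
    bumped : LocalHCT (setCell G n (suc c) x)
    bumped = bump-local H n c x x≺cur left⪯x passed (λ i p → coming i (m<n⇒m<1+n p))
    passed′ : ∀ j → n ≤ j → Separates (setCell G n (suc c) x) y j c
    passed′ j p with m≤n⇒m<n∨m≡n p
    ... | inj₁ n<j  = separates-setCell G n (suc c) x y j c (λ e → <-irrefl (sym e) n<j)
                        (displaced-above H cur≡y j n<j)
    ... | inj₂ refl rewrite setCell-hit G n c x (⪯letter⇒≢∞ left⪯x)
                          | setCell-miss G n (suc c) x n c (inj₂ λ e → 1+n≢n (sym e)) = inj₂ x≺y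
    coming′ : ∀ i → i < n → Separates (setCell G n (suc c) x) y i (suc c)
    coming′ i p = separates-setCell G n (suc c) x y i (suc c) (λ e → <-irrefl e p)
                    (displaced-below H cur≡y x≺y left⪯x i p (coming i (m<n⇒m<1+n p)))

  scan-columns : ∀ r c (G : Filling k l) x → LocalHCT G → numRows G ≡ r →
    (∀ i → Separates G x i c) → LocalHCT (scan x (readingOrder r c) G)
  scan-columns r zero    G x H _    sep = newRow-local G x H sep
  scan-columns r (suc c) G x H rows sep =
    scan-column r c (readingOrder r c) (scan-columns r c) r G x H rows above-top (λ i _ → sep i)
    where
    above-top : ∀ j → r ≤ j → Separates G x j c
    above-top j p rewrite hat-above-top G j c (subst (_≤ j) (sym rows) p) = inj₁ (≺∞ λ ())

lemma5p2 : ∀ {k l : ℕ} (F : Filling k l) (x : Letter k l) → IsHCT F → IsHCT (insert F x)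
lemma5p2 F x H =
  local⇒isHCT (insert F x)
    (scan-columns (numRows F) (maxLen F) F x (isHCT⇒local F H) refl separates-rightmost)
  where
  -- column maxLen F is empty, so x separates its pairs trivially
  separates-rightmost : ∀ i → Separates F x i (maxLen F)
  separates-rightmost i rewrite hat-beyond-maxLen F i = inj₁ (≺∞ λ ())
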